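{- For any derivation $\mathcal{D}$ witnessing $\vdash_{\mathsf{GT}^- }\Gamma \Rightarrow \Delta$, each formula occurring in $\mathcal{D}$ is a subformula of a partial resolution of some formula occurring in $\Gamma,\Delta$.
   Context: Classical formulas: $\alpha::=p\mid\bot\mid\neg\alpha\mid\alpha\wedge\alpha\mid\alpha\vee\alpha$; formulas of $\mathbf{PL}(\mathbin{\backslash\!\!\!/})$: $\phi::=\alpha\mid\phi\wedge\phi\mid\phi\vee\phi\mid\phi\mathbin{\backslash\!\!\!/}\phi$ ($\vee$ split disjunction, $\mathbin{\backslash\!\!\!/}$ inquisitive disjunction). $\mathsf{GT}^-$ is the cut-free calculus ($\alpha$ classical, $\Lambda$ a multiset of classical formulas) with axioms $\Gamma,p\Rightarrow p,\Delta$, $\Gamma,\bot\Rightarrow\Delta$ and rules $\mathsf{L}\neg$ ($\Gamma\Rightarrow\alpha,\Delta$ / $\Gamma,\neg\alpha\Rightarrow\Delta$), $\mathsf{R}\neg$ ($\Gamma,\alpha\Rightarrow\Delta$ / $\Gamma\Rightarrow\neg\alpha,\Delta$), $\mathsf{L}\wedge$ ($\Gamma,\phi,\psi\Rightarrow\Delta$ / $\Gamma,\phi\wedge\psi\Rightarrow\Delta$), $\mathsf{R}\wedge$ ($\Gamma\Rightarrow\phi,\Lambda$ and $\Gamma\Rightarrow\psi,\Lambda$ / $\Gamma\Rightarrow\phi\wedge\psi,\Lambda,\Delta$), $\mathsf{L}\vee$ ($\Gamma,\phi\Rightarrow\Lambda$ and $\Gamma,\psi\Rightarrow\Lambda$ /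 $\Gamma,\phi\vee\psi\Rightarrow\Lambda,\Delta$), $\mathsf{R}\vee$ ($\Gamma\Rightarrow\phi,\psi,\Delta$ / $\Gamma\Rightarrow\phi\vee\psi,\Delta$), $\mathsf{L}\mathbin{\backslash\!\!\!/}$ ($\Gamma,\chi\{\phi_L\}\Rightarrow\Delta$ and $\Gamma,\chi\{\phi_R\}\Rightarrow\Delta$ / $\Gamma,\chi\{\phi_L\mathbin{\backslash\!\!\!/}\phi_R\}\Rightarrow\Delta$), $\mathsf{R}\mathbin{\backslash\!\!\!/}$ ($\Gamma\Rightarrow\chi\{\phi_i\},\Delta$, $i\in\{L,R\}$ / $\Gamma\Rightarrow\chi\{\phi_L\mathbin{\backslash\!\!\!/}\phi_R\},\Delta$), where $\chi\{\eta\}$ replaces a fixed subformula occurrence of $\chi$ not in the scope of a negation by $\eta$. Partial resolutions: label each occurrence of $\mathbin{\backslash\!\!\!/}$ in $\phi$ by its position $0,1,\dots,|\phi|-1$ from left to right, where $|\phi|$ is the number of occurrences of $\mathbin{\backslash\!\!\!/}$ in $\phi$. For $i\in\{L,R\}$ and a label $j$, $\phi[i/j]$ is the result of replacing the subformula occurrence $\chi_L\mathbin{\backslash\!\!\!/}_j\chi_R$ (the occurrence of $\mathbin{\backslash\!\!\!/}$ labelled $j$ together with its arguments) by $\chi_i$, labels being kept; iterated substitutions $\phi[i_1/j_1]\cdots[i_n/j_n]$ use distinct labels $j_1,\dots,j_n$. The partial resolutions of $\phi$ of degree $n$ are all such $\phi[i_1/j_1]\cdots[i_n/j_n]$ (degree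 0 gives $\phi$ itself), and the partial resolutions of $\phi$ are those of any degree $0\le n\le|\phi|$ (labels are then ignored). -}

module Defs where

open import Data.Nat using (ℕ; zero; suc; _+_; _<_; _≤_; _≟_)
open import Data.List using (List; []; _∷_; _++_; length; map; foldl)
open import Data.List.Relation.Unary.All using (All)
open import Data.List.Relation.Unary.Unique.Propositional using (Unique)
open import Data.List.Relation.Binary.Permutation.Propositional using (_↭_)
open import Data.Product using (_×_; _,_; Σ; ∃-syntax; proj₂)
open import Data.Empty using (⊥)
open import Data.Unit using (⊤)
open import Relation.Nullary using (yes; no)
open import Relation.Binary.PropositionalEquality using (_≡_)

-- Formulas of PL(⩔). Atoms are indexed by ℕ.
-- `⩔` is inquisitive disjunction, `∨` is split disjunction.

infixr 6 _∧_
infixr 5 _∨_ _⩔_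

data Form : Set where
  atom : ℕ → Form
  ⊥f   : Form
  ¬_   : Form → Form
  _∧_  : Form → Form → Form
  _∨_  : Form → Form → Form
  _⩔_  : Form → Form → Form

Classical : Form → Set
Classical (atom _) = ⊤
Classical ⊥f = ⊤
Classical (¬ a) = Classical a
Classical (a ∧ b) = Classical a × Classical b
Classical (a ∨ b) = Classical a × Classical b
Classical (a ⩔ b) = ⊥

WF : Form → Set
WF (atom _) = ⊤
WF ⊥f = ⊤
WF (¬ a) = Classical a
WF (a ∧ b) = WF a × WF b
WF (a ∨ b) = WF a × WF b
WF (a ⩔ b) = WF a × WF b

data Sub : Form → Form → Set where
  here : ∀ {φ} → Sub φ φ
  ¬s   : ∀ {ψ a} → Sub ψ a → Sub ψ (¬ a)
  ∧l   : ∀ {ψ a b} → Sub ψ a → Sub ψ (a ∧ b)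
  ∧r   : ∀ {ψ a b} → Sub ψ b → Sub ψ (a ∧ b)
  ∨l   : ∀ {ψ a b} → Sub ψ a → Sub ψ (a ∨ b)
  ∨r   : ∀ {ψ a b} → Sub ψ b → Sub ψ (a ∨ b)
  ⩔l   : ∀ {ψ a b} → Sub ψ a → Sub ψ (a ⩔ b)
  ⩔r   : ∀ {ψ a b} → Sub ψ b → Sub ψ (a ⩔ b)

-- Contexts χ{·}: a single hole, never in the scope of a negation

data Ctx : Set where
  hole : Ctx
  _∧ₗ_ : Ctx → Form → Ctx
  _∧ᵣ_ : Form → Ctx → Ctx
  _∨ₗ_ : Ctx → Form → Ctx
  _∨ᵣ_ : Form → Ctx → Ctx
  _⩔ₗ_ : Ctx → Form → Ctx
  _⩔ᵣ_ : Form → Ctx → Ctx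

_⟦_⟧ : Ctx → Form → Form
hole ⟦ η ⟧ = η
(c ∧ₗ b) ⟦ η ⟧ = (c ⟦ η ⟧) ∧ b
(a ∧ᵣ c) ⟦ η ⟧ = a ∧ (c ⟦ η ⟧)
(c ∨ₗ b) ⟦ η ⟧ = (c ⟦ η ⟧) ∨ b
(a ∨ᵣ c) ⟦ η ⟧ = a ∨ (c ⟦ η ⟧)
(c ⩔ₗ b) ⟦ η ⟧ = (c ⟦ η ⟧) ⩔ b
(a ⩔ᵣ c) ⟦ η ⟧ = a ⩔ (c ⟦ η ⟧)

-- The calculus GT⁻. Sequents are pairs of lists; multisets are modelled
-- by lists together with an explicit exchange rule (`perm`).

data Side : Set where
  L R : Side

pick : Side → Form → Form → Form
pick L a b = a
pick R a b = b

infix 4 _⇒_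

data _⇒_ : List Form → List Form → Set where
  ax   : ∀ {Γ Δ} p → (atom p ∷ Γ) ⇒ (atom p ∷ Δ)
  ⊥L   : ∀ {Γ Δ} → (⊥f ∷ Γ) ⇒ Δ
  ¬L   : ∀ {Γ Δ α} → Classical α → Γ ⇒ (α ∷ Δ) → ((¬ α) ∷ Γ) ⇒ Δ
  ¬R   : ∀ {Γ Δ α} → Classical α → (α ∷ Γ) ⇒ Δ → Γ ⇒ ((¬ α) ∷ Δ)
  ∧L   : ∀ {Γ Δ φ ψ} → (φ ∷ ψ ∷ Γ) ⇒ Δ → ((φ ∧ ψ) ∷ Γ) ⇒ Δ
  ∧R   : ∀ {Γ Λ Δ φ ψ} → All Classical Λ →
         Γ ⇒ (φ ∷ Λ) → Γ ⇒ (ψ ∷ Λ) → Γ ⇒ ((φ ∧ ψ) ∷ (Λ ++ Δ))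
  ∨L   : ∀ {Γ Λ Δ φ ψ} → All Classical Λ →
         (φ ∷ Γ) ⇒ Λ → (ψ ∷ Γ) ⇒ Λ → ((φ ∨ ψ) ∷ Γ) ⇒ (Λ ++ Δ)
  ∨R   : ∀ {Γ Δ φ ψ} → Γ ⇒ (φ ∷ ψ ∷ Δ) → Γ ⇒ ((φ ∨ ψ) ∷ Δ)
  ⩔L   : ∀ {Γ Δ} (χ : Ctx) φL φR →
         ((χ ⟦ φL ⟧) ∷ Γ) ⇒ Δ → ((χ ⟦ φR ⟧) ∷ Γ) ⇒ Δ →
         ((χ ⟦ φL ⩔ φR ⟧) ∷ Γ) ⇒ Δ
  ⩔R   : ∀ {Γ Δ} (χ : Ctx) φL φR (i : Side) →
         Γ ⇒ ((χ ⟦ pick i φL φR ⟧) ∷ Δ) → Γ ⇒ ((χ ⟦ φL ⩔ φR ⟧) ∷ Δ)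
  perm : ∀ {Γ Γ' Δ Δ'} → Γ ↭ Γ' → Δ ↭ Δ' → Γ ⇒ Δ → Γ' ⇒ Δ'

formulas : ∀ {Γ Δ} → Γ ⇒ Δ → List Form
formulas {Γ} {Δ} d = Γ ++ Δ ++ rest d
  where
  rest : ∀ {Γ Δ} → Γ ⇒ Δ → List Form
  rest (ax p) = []
  rest ⊥L = []
  rest (¬L _ d) = formulas d
  rest (¬R _ d) = formulas d
  rest (∧L d) = formulas d
  rest (∧R _ d e) = formulas d ++ formulas e
  rest (∨L _ d e) = formulas d ++ formulas e
  rest (∨R d) = formulas d
  rest (⩔L _ _ _ d e) = formulas d ++ formulas e
  rest (⩔R _ _ _ _ d) = formulas d
  rest (perm _ _ d) = formulas d

∣_∣ : Form → ℕ
∣ atom _ ∣ = 0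
∣ ⊥f ∣ = 0
∣ ¬ a ∣ = ∣ a ∣
∣ a ∧ b ∣ = ∣ a ∣ + ∣ b ∣
∣ a ∨ b ∣ = ∣ a ∣ + ∣ b ∣
∣ a ⩔ b ∣ = suc (∣ a ∣ + ∣ b ∣)

data LForm : Set where
  atom : ℕ → LForm
  ⊥f   : LForm
  ¬_   : LForm → LForm
  _∧_  : LForm → LForm → LForm
  _∨_  : LForm → LForm → LForm
  lor  : ℕ → LForm → LForm → LForm

labelFrom : ℕ → Form → LForm
labelFrom k (atom p) = atom p
labelFrom k ⊥f = ⊥f
labelFrom k (¬ a) = ¬ labelFrom k a
labelFrom k (a ∧ b) = labelFrom k a ∧ labelFrom (k + ∣ a ∣) b
labelFrom k (a ∨ b) = labelFrom k a ∨ labelFrom (k + ∣ a ∣) b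
labelFrom k (a ⩔ b) = lor (k + ∣ a ∣) (labelFrom k a) (labelFrom (suc (k + ∣ a ∣)) b)

label : Form → LForm
label = labelFrom 0

erase : LForm → Form
erase (atom p) = atom p
erase ⊥f = ⊥f
erase (¬ a) = ¬ erase a
erase (a ∧ b) = erase a ∧ erase b
erase (a ∨ b) = erase a ∨ erase b
erase (lor _ a b) = erase a ⩔ erase b

pickL : Side → LForm → LForm → LForm
pickL L a b = a
pickL R a b = b

subst : Side → ℕ → LForm → LForm
subst i j (atom p) = atom p
subst i j ⊥f = ⊥f
subst i j (¬ a) = ¬ subst i j a
subst i j (a ∧ b) = subst i j a ∧ subst i j b
subst i j (a ∨ b) = subst i j a ∨ subst i j b
subst i j (lor k a b) with j ≟ k
... | yes _ = pickL i a b
... | no _  = lor k (subst i j a) (subst i j b)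

substs : List (Side × ℕ) → LForm → LForm
substs s φ = foldl (λ ψ ij → subst (Data.Product.proj₁ ij) (proj₂ ij) ψ) φ s

PartialResDeg : ℕ → Form → Form → Set
PartialResDeg n φ ψ =
  Σ (List (Side × ℕ)) λ s →
    length s ≡ n
    × All (λ ij → proj₂ ij < ∣ φ ∣) s
    × Unique (map proj₂ s)
    × erase (substs s (label φ)) ≡ ψ

PartialRes : Form → Form → Set
PartialRes φ ψ = ∃[ n ] (n ≤ ∣ φ ∣ × PartialResDeg n φ ψ)

{-# OPTIONS --safe #-}

-- The inductive relation φ ↝ ρ resolves any set of occurrences of ⩔ at once.
-- Every premise formula of a GT⁻ rule is a side formula, an immediate subformula
-- of the principal formula, or (for ⩔L, ⩔R) a one-step resolution χ⟦φᵢ⟧ of it.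
-- "Subformula of a ↝-resolution of" is transitive, because a resolution of a
-- subformula extends to one of the whole formula, so induction on the derivation
-- gives the theorem for ↝. Every ↝-resolution is a labelled partial resolution
-- since labelFrom k φ only uses labels in [k, k + ∣ φ ∣): the two sides of a
-- connective carry disjoint labels, so substitution lists resolving them
-- separately can be concatenated.

module Submission where

open import Defs
open import Data.List using (List; []; _∷_; [_]; _++_; length; map)
open import Data.List.Properties using (++-assoc; map-++; foldl-++; length-++)
open import Data.List.Membership.Propositional using (_∈_)
open import Data.List.Membership.Propositional.Properties using (∈-++⁻; ∈-++⁺ˡ; ∈-++⁺ʳ; ∈-insert)
open import Data.List.Relation.Unary.Any using (here; there)
open import Data.List.Relation.Unary.All as All using (All; []; _∷_)
import Data.List.Relation.Unary.All.Properties as All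
open import Data.List.Relation.Unary.AllPairs using ([]; _∷_)
open import Data.List.Relation.Unary.Unique.Propositional using (Unique)
import Data.List.Relation.Unary.Unique.Propositional.Properties as Unique
open import Data.List.Relation.Binary.Disjoint.Propositional using (Disjoint)
open import Data.List.Relation.Binary.Subset.Propositional using (_⊆_)
open import Data.List.Relation.Binary.Subset.Propositional.Properties
  using (⊆-refl; ⊆-trans; ⊆-reflexive; ⊆-reflexive-↭; xs⊆x∷xs; xs⊆xs++ys; ++⁺ʳ)
import Data.List.Relation.Binary.Permutation.Propositional.Properties as Perm
open import Data.Nat using (ℕ; suc; _+_; _≤_; _<_; _≟_)
open import Data.Nat.Properties
open import Data.Product using (_×_; _,_; proj₂; ∃-syntax)
open import Function using (_∘_)
open import Data.Empty using (⊥-elim)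
open import Data.Sum using (inj₁; inj₂; [_,_]′)
open import Relation.Nullary using (yes; no)
open import Relation.Binary.PropositionalEquality as ≡ using (_≡_; _≢_; ≢-sym; refl; sym; trans; cong; cong₂)

private variable
  Γ Δ Λ xs ys zs : List Form
  φ ψ θ η ρ σ a a' b b' : Form
  X Y : LForm
  s t : List (Side × ℕ)
  lo lo' mid mid' hi hi' j m : ℕ
  P Q : ℕ → Set

infix 4 _↝_ _⊴_ _⊴ₛ_

data _↝_ : Form → Form → Set where
  atom     : ∀ {p} → atom p ↝ atom p
  ⊥f       : ⊥f ↝ ⊥f
  ¬_       : a ↝ a' → ¬ a ↝ ¬ a'
  _∧_      : a ↝ a' → b ↝ b' → a ∧ b ↝ a' ∧ b'
  _∨_      : a ↝ a' → b ↝ b' → a ∨ b ↝ a' ∨ b'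
  _⩔_      : a ↝ a' → b ↝ b' → a ⩔ b ↝ a' ⩔ b'
  resolveˡ : a ↝ a' → a ⩔ b ↝ a'
  resolveʳ : b ↝ b' → a ⩔ b ↝ b'

↝-refl : ∀ φ → φ ↝ φ
↝-refl (atom _) = atom
↝-refl ⊥f = ⊥f
↝-refl (¬ a) = ¬ ↝-refl a
↝-refl (a ∧ b) = ↝-refl a ∧ ↝-refl b
↝-refl (a ∨ b) = ↝-refl a ∨ ↝-refl b
↝-refl (a ⩔ b) = ↝-refl a ⩔ ↝-refl b

↝-trans : φ ↝ ψ → ψ ↝ θ → φ ↝ θ
↝-trans atom q = q
↝-trans ⊥f q = q
↝-trans (¬ p) (¬ q) = ¬ ↝-trans p q
↝-trans (p ∧ p') (q ∧ q') = ↝-trans p q ∧ ↝-trans p' q'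
↝-trans (p ∨ p') (q ∨ q') = ↝-trans p q ∨ ↝-trans p' q'
↝-trans (p ⩔ p') (q ⩔ q') = ↝-trans p q ⩔ ↝-trans p' q'
↝-trans (p ⩔ p') (resolveˡ q) = resolveˡ (↝-trans p q)
↝-trans (p ⩔ p') (resolveʳ q) = resolveʳ (↝-trans p' q)
↝-trans (resolveˡ p) q = resolveˡ (↝-trans p q)
↝-trans (resolveʳ p) q = resolveʳ (↝-trans p q)

plug-↝ : ∀ χ φL φR i → χ ⟦ φL ⩔ φR ⟧ ↝ χ ⟦ pick i φL φR ⟧
plug-↝ hole φL φR L = resolveˡ (↝-refl φL)
plug-↝ hole φL φR R = resolveʳ (↝-refl φR)
plug-↝ (χ ∧ₗ b) φL φR i = plug-↝ χ φL φR i ∧ ↝-refl b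
plug-↝ (a ∧ᵣ χ) φL φR i = ↝-refl a ∧ plug-↝ χ φL φR i
plug-↝ (χ ∨ₗ b) φL φR i = plug-↝ χ φL φR i ∨ ↝-refl b
plug-↝ (a ∨ᵣ χ) φL φR i = ↝-refl a ∨ plug-↝ χ φL φR i
plug-↝ (χ ⩔ₗ b) φL φR i = plug-↝ χ φL φR i ⩔ ↝-refl b
plug-↝ (a ⩔ᵣ χ) φL φR i = ↝-refl a ⩔ plug-↝ χ φL φR i

Sub-trans : Sub φ ψ → Sub ψ θ → Sub φ θ
Sub-trans p here = p
Sub-trans p (¬s q) = ¬s (Sub-trans p q)
Sub-trans p (∧l q) = ∧l (Sub-trans p q)
Sub-trans p (∧r q) = ∧r (Sub-trans p q)
Sub-trans p (∨l q) = ∨l (Sub-trans p q)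
Sub-trans p (∨r q) = ∨r (Sub-trans p q)
Sub-trans p (⩔l q) = ⩔l (Sub-trans p q)
Sub-trans p (⩔r q) = ⩔r (Sub-trans p q)

Sub-extend-↝ : Sub ψ θ → ψ ↝ ρ → ∃[ σ ] (θ ↝ σ × Sub ρ σ)
Sub-extend-↝ here p = _ , p , here
Sub-extend-↝ (¬s q) p with Sub-extend-↝ q p
... | σ , r , u = ¬ σ , ¬ r , ¬s u
Sub-extend-↝ (∧l {b = b} q) p with Sub-extend-↝ q p
... | σ , r , u = σ ∧ b , r ∧ ↝-refl b , ∧l u
Sub-extend-↝ (∧r {a = a} q) p with Sub-extend-↝ q p
... | σ , r , u = a ∧ σ , ↝-refl a ∧ r , ∧r u
Sub-extend-↝ (∨l {b = b} q) p with Sub-extend-↝ q p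
... | σ , r , u = σ ∨ b , r ∨ ↝-refl b , ∨l u
Sub-extend-↝ (∨r {a = a} q) p with Sub-extend-↝ q p
... | σ , r , u = a ∨ σ , ↝-refl a ∨ r , ∨r u
Sub-extend-↝ (⩔l {b = b} q) p with Sub-extend-↝ q p
... | σ , r , u = σ ⩔ b , r ⩔ ↝-refl b , ⩔l u
Sub-extend-↝ (⩔r {a = a} q) p with Sub-extend-↝ q p
... | σ , r , u = a ⩔ σ , ↝-refl a ⩔ r , ⩔r u

_⊴_ : Form → Form → Set
φ ⊴ θ = ∃[ ρ ] (θ ↝ ρ × Sub φ ρ)

Sub⇒⊴ : Sub φ θ → φ ⊴ θ
Sub⇒⊴ {θ = θ} p = θ , ↝-refl θ , p

↝⇒⊴ : θ ↝ φ → φ ⊴ θ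
↝⇒⊴ p = _ , p , here

⊴-trans : φ ⊴ θ → θ ⊴ η → φ ⊴ η
⊴-trans (ρ , θ↝ρ , φ⊑ρ) (σ , η↝σ , θ⊑σ) with Sub-extend-↝ θ⊑σ θ↝ρ
... | τ , σ↝τ , ρ⊑τ = τ , ↝-trans η↝σ σ↝τ , Sub-trans φ⊑ρ ρ⊑τ

_⊴ₛ_ : List Form → List Form → Set
xs ⊴ₛ ys = ∀ {φ} → φ ∈ xs → ∃[ θ ] (θ ∈ ys × φ ⊴ θ)

⊆⇒⊴ₛ : xs ⊆ ys → xs ⊴ₛ ys
⊆⇒⊴ₛ xs⊆ys {φ} φ∈xs = φ , xs⊆ys φ∈xs , Sub⇒⊴ here

⊴ₛ-trans : xs ⊴ₛ ys → ys ⊴ₛ zs → xs ⊴ₛ zs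
⊴ₛ-trans xs⊴ys ys⊴zs φ∈xs with xs⊴ys φ∈xs
... | θ , θ∈ys , φ⊴θ with ys⊴zs θ∈ys
...   | η , η∈zs , θ⊴η = η , η∈zs , ⊴-trans φ⊴θ θ⊴η

++-⊴ₛ : xs ⊴ₛ zs → ys ⊴ₛ zs → xs ++ ys ⊴ₛ zs
++-⊴ₛ {xs} xs⊴zs ys⊴zs φ∈ = [ xs⊴zs , ys⊴zs ]′ (∈-++⁻ xs φ∈)

insert-⊴ₛ : ∀ Γ → φ ⊴ θ → θ ∈ zs → Γ ++ Δ ⊴ₛ zs → Γ ++ φ ∷ Δ ⊴ₛ zs
insert-⊴ₛ Γ φ⊴θ θ∈zs rest⊴zs ψ∈ with ∈-++⁻ Γ ψ∈
... | inj₁ ψ∈Γ = rest⊴zs (∈-++⁺ˡ ψ∈Γ)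
... | inj₂ (here refl) = _ , θ∈zs , φ⊴θ
... | inj₂ (there ψ∈Δ) = rest⊴zs (∈-++⁺ʳ Γ ψ∈Δ)

endsequent-⊴ₛ : ∀ Γ Δ → xs ⊴ₛ Γ ++ Δ → Γ ++ Δ ++ xs ⊴ₛ Γ ++ Δ
endsequent-⊴ₛ Γ Δ xs⊴ =
  ⊴ₛ-trans (⊆⇒⊴ₛ (⊆-reflexive (sym (++-assoc Γ Δ _)))) (++-⊴ₛ (⊆⇒⊴ₛ ⊆-refl) xs⊴)

⊆-insert : ∀ (Γ Δ : List Form) θ → Γ ++ Δ ⊆ Γ ++ θ ∷ Δ
⊆-insert Γ Δ θ = ++⁺ʳ Γ (xs⊆x∷xs Δ θ)

⊆-++-middle : ∀ (Γ Λ Δ : List Form) → Γ ++ Λ ⊆ Γ ++ Λ ++ Δ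
⊆-++-middle Γ Λ Δ = ++⁺ʳ Γ (xs⊆xs++ys Λ Δ)

formulas-⊴ₛ : (D : Γ ⇒ Δ) → formulas D ⊴ₛ Γ ++ Δ
formulas-⊴ₛ {Γ} {Δ} (ax p) = endsequent-⊴ₛ Γ Δ λ ()
formulas-⊴ₛ {Γ} {Δ} ⊥L = endsequent-⊴ₛ Γ Δ λ ()
formulas-⊴ₛ {¬α ∷ Γ} {Δ} (¬L _ d) = endsequent-⊴ₛ (¬α ∷ Γ) Δ (⊴ₛ-trans (formulas-⊴ₛ d)
  (insert-⊴ₛ Γ (Sub⇒⊴ (¬s here)) (here refl) (⊆⇒⊴ₛ there)))
formulas-⊴ₛ {Γ} {¬α ∷ Δ} (¬R _ d) = endsequent-⊴ₛ Γ (¬α ∷ Δ) (⊴ₛ-trans (formulas-⊴ₛ d)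
  (insert-⊴ₛ [] (Sub⇒⊴ (¬s here)) (∈-insert Γ) (⊆⇒⊴ₛ (⊆-insert Γ Δ ¬α))))
formulas-⊴ₛ {φ∧ψ ∷ Γ} {Δ} (∧L d) = endsequent-⊴ₛ (φ∧ψ ∷ Γ) Δ (⊴ₛ-trans (formulas-⊴ₛ d)
  (insert-⊴ₛ [] (Sub⇒⊴ (∧l here)) (here refl)
    (insert-⊴ₛ [] (Sub⇒⊴ (∧r here)) (here refl) (⊆⇒⊴ₛ there))))
formulas-⊴ₛ {Γ} {φ∧ψ ∷ Δ} (∧R {Λ = Λ} {Δ = Δ'} _ d e) = endsequent-⊴ₛ Γ (φ∧ψ ∷ Δ) (++-⊴ₛ
  (⊴ₛ-trans (formulas-⊴ₛ d) (insert-⊴ₛ Γ (Sub⇒⊴ (∧l here)) (∈-insert Γ) side))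
  (⊴ₛ-trans (formulas-⊴ₛ e) (insert-⊴ₛ Γ (Sub⇒⊴ (∧r here)) (∈-insert Γ) side)))
  where
  side : Γ ++ Λ ⊴ₛ Γ ++ φ∧ψ ∷ Λ ++ Δ'
  side = ⊆⇒⊴ₛ (⊆-trans (⊆-++-middle Γ Λ Δ') (⊆-insert Γ (Λ ++ Δ') φ∧ψ))
formulas-⊴ₛ {φ∨ψ ∷ Γ} {Δ} (∨L {Λ = Λ} {Δ = Δ'} _ d e) = endsequent-⊴ₛ (φ∨ψ ∷ Γ) Δ (++-⊴ₛ
  (⊴ₛ-trans (formulas-⊴ₛ d) (insert-⊴ₛ [] (Sub⇒⊴ (∨l here)) (here refl) side))
  (⊴ₛ-trans (formulas-⊴ₛ e) (insert-⊴ₛ [] (Sub⇒⊴ (∨r here)) (here refl) side)))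
  where
  side : Γ ++ Λ ⊴ₛ φ∨ψ ∷ Γ ++ Λ ++ Δ'
  side = ⊆⇒⊴ₛ (there ∘ ⊆-++-middle Γ Λ Δ')
formulas-⊴ₛ {Γ} {φ∨ψ ∷ Δ} (∨R d) = endsequent-⊴ₛ Γ (φ∨ψ ∷ Δ) (⊴ₛ-trans (formulas-⊴ₛ d)
  (insert-⊴ₛ Γ (Sub⇒⊴ (∨l here)) (∈-insert Γ)
    (insert-⊴ₛ Γ (Sub⇒⊴ (∨r here)) (∈-insert Γ) (⊆⇒⊴ₛ (⊆-insert Γ Δ φ∨ψ)))))
formulas-⊴ₛ {χφ ∷ Γ} {Δ} (⩔L χ φL φR d e) = endsequent-⊴ₛ (χφ ∷ Γ) Δ (++-⊴ₛ
  (⊴ₛ-trans (formulas-⊴ₛ d) (insert-⊴ₛ [] (↝⇒⊴ (plug-↝ χ φL φR L)) (here refl) side))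
  (⊴ₛ-trans (formulas-⊴ₛ e) (insert-⊴ₛ [] (↝⇒⊴ (plug-↝ χ φL φR R)) (here refl) side)))
  where
  side : Γ ++ Δ ⊴ₛ χφ ∷ Γ ++ Δ
  side = ⊆⇒⊴ₛ there
formulas-⊴ₛ {Γ} {χφ ∷ Δ} (⩔R χ φL φR i d) = endsequent-⊴ₛ Γ (χφ ∷ Δ) (⊴ₛ-trans (formulas-⊴ₛ d)
  (insert-⊴ₛ Γ (↝⇒⊴ (plug-↝ χ φL φR i)) (∈-insert Γ) (⊆⇒⊴ₛ (⊆-insert Γ Δ χφ))))
formulas-⊴ₛ {Γ} {Δ} (perm Γ↭ Δ↭ d) = endsequent-⊴ₛ Γ Δ (⊴ₛ-trans (formulas-⊴ₛ d)
  (⊆⇒⊴ₛ (⊆-reflexive-↭ (Perm.++⁺ Γ↭ Δ↭))))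

data AllLabels (P : ℕ → Set) : LForm → Set where
  atom : ∀ {p} → AllLabels P (atom p)
  ⊥f   : AllLabels P ⊥f
  ¬_   : AllLabels P X → AllLabels P (¬ X)
  _∧_  : AllLabels P X → AllLabels P Y → AllLabels P (X ∧ Y)
  _∨_  : AllLabels P X → AllLabels P Y → AllLabels P (X ∨ Y)
  lor  : P j → AllLabels P X → AllLabels P Y → AllLabels P (lor j X Y)

AllLabels-map : (∀ {j} → P j → Q j) → AllLabels P X → AllLabels Q X
AllLabels-map f atom = atom
AllLabels-map f ⊥f = ⊥f
AllLabels-map f (¬ p) = ¬ AllLabels-map f p
AllLabels-map f (p ∧ q) = AllLabels-map f p ∧ AllLabels-map f q
AllLabels-map f (p ∨ q) = AllLabels-map f p ∨ AllLabels-map f q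
AllLabels-map f (lor x p q) = lor (f x) (AllLabels-map f p) (AllLabels-map f q)

labelFrom-≥ : ∀ k φ → AllLabels (k ≤_) (labelFrom k φ)
labelFrom-≥ k (atom _) = atom
labelFrom-≥ k ⊥f = ⊥f
labelFrom-≥ k (¬ a) = ¬ labelFrom-≥ k a
labelFrom-≥ k (a ∧ b) = labelFrom-≥ k a ∧ AllLabels-map (≤-trans (m≤m+n k ∣ a ∣)) (labelFrom-≥ _ b)
labelFrom-≥ k (a ∨ b) = labelFrom-≥ k a ∨ AllLabels-map (≤-trans (m≤m+n k ∣ a ∣)) (labelFrom-≥ _ b)
labelFrom-≥ k (a ⩔ b) = lor (m≤m+n k ∣ a ∣) (labelFrom-≥ k a)
  (AllLabels-map (≤-trans (≤-trans (m≤m+n k ∣ a ∣) (n≤1+n _))) (labelFrom-≥ _ b))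

⩔-size : ∀ k a b → suc (k + a) + b ≡ k + suc (a + b)
⩔-size k a b = trans (cong suc (+-assoc k a b)) (sym (+-suc k (a + b)))

labelFrom-< : ∀ k φ → AllLabels (_< k + ∣ φ ∣) (labelFrom k φ)
labelFrom-< k (atom _) = atom
labelFrom-< k ⊥f = ⊥f
labelFrom-< k (¬ a) = ¬ labelFrom-< k a
labelFrom-< k (a ∧ b) =
  AllLabels-map (λ j< → <-≤-trans j< (+-monoʳ-≤ k (m≤m+n ∣ a ∣ ∣ b ∣))) (labelFrom-< k a) ∧
  AllLabels-map (λ j< → ≤-trans j< (≤-reflexive (+-assoc k ∣ a ∣ ∣ b ∣))) (labelFrom-< _ b)
labelFrom-< k (a ∨ b) =
  AllLabels-map (λ j< → <-≤-trans j< (+-monoʳ-≤ k (m≤m+n ∣ a ∣ ∣ b ∣))) (labelFrom-< k a) ∨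
  AllLabels-map (λ j< → ≤-trans j< (≤-reflexive (+-assoc k ∣ a ∣ ∣ b ∣))) (labelFrom-< _ b)
labelFrom-< k (a ⩔ b) = lor m<hi (AllLabels-map (λ j< → <-trans j< m<hi) (labelFrom-< k a))
  (AllLabels-map (λ j< → ≤-trans j< (≤-reflexive (⩔-size k ∣ a ∣ ∣ b ∣))) (labelFrom-< _ b))
  where
  m<hi : k + ∣ a ∣ < k + ∣ a ⩔ b ∣
  m<hi = ≤-trans (m≤m+n _ ∣ b ∣) (≤-reflexive (⩔-size k ∣ a ∣ ∣ b ∣))

pickL-elim : ∀ (Pr : LForm → Set) i → Pr X → Pr Y → Pr (pickL i X Y)
pickL-elim Pr L p q = p
pickL-elim Pr R p q = q

subst-AllLabels : ∀ i j → AllLabels P X → AllLabels P (subst i j X)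
subst-AllLabels i j atom = atom
subst-AllLabels i j ⊥f = ⊥f
subst-AllLabels i j (¬ p) = ¬ subst-AllLabels i j p
subst-AllLabels i j (p ∧ q) = subst-AllLabels i j p ∧ subst-AllLabels i j q
subst-AllLabels i j (p ∨ q) = subst-AllLabels i j p ∨ subst-AllLabels i j q
subst-AllLabels i j (lor {j = k} x p q) with j ≟ k
... | yes _ = pickL-elim (AllLabels _) i p q
... | no _ = lor x (subst-AllLabels i j p) (subst-AllLabels i j q)

subst-fresh : ∀ i j → AllLabels (j ≢_) X → subst i j X ≡ X
subst-fresh i j atom = refl
subst-fresh i j ⊥f = refl
subst-fresh i j (¬ p) = cong ¬_ (subst-fresh i j p)
subst-fresh i j (p ∧ q) = cong₂ _∧_ (subst-fresh i j p) (subst-fresh i j q)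
subst-fresh i j (p ∨ q) = cong₂ _∨_ (subst-fresh i j p) (subst-fresh i j q)
subst-fresh i j (lor {j = k} j≢k p q) with j ≟ k
... | yes j≡k = ⊥-elim (j≢k j≡k)
... | no _ = cong₂ (lor k) (subst-fresh i j p) (subst-fresh i j q)

subst-lor-≢ : ∀ i {X Y} → j ≢ m → subst i j (lor m X Y) ≡ lor m (subst i j X) (subst i j Y)
subst-lor-≢ {j} {m} i j≢m with j ≟ m
... | yes j≡m = ⊥-elim (j≢m j≡m)
... | no _ = refl

subst-lor-≡ : ∀ i m {X Y} → subst i m (lor m X Y) ≡ pickL i X Y
subst-lor-≡ i m rewrite ≟-diag (refl {x = m}) = refl

Fresh : List (Side × ℕ) → LForm → Set
Fresh s X = All (λ ij → AllLabels (proj₂ ij ≢_) X) s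

substs-AllLabels : ∀ s → AllLabels P X → AllLabels P (substs s X)
substs-AllLabels [] p = p
substs-AllLabels ((i , j) ∷ s) p = substs-AllLabels s (subst-AllLabels i j p)

substs-fresh : Fresh s X → substs s X ≡ X
substs-fresh [] = refl
substs-fresh {(i , j) ∷ s} {X} (p ∷ ps) = trans (cong (substs s) (subst-fresh i j p)) (substs-fresh ps)

Fresh-separated : (∀ {j k} → P j → Q k → j ≢ k) →
                  All (λ ij → P (proj₂ ij)) s → AllLabels Q X → Fresh s X
Fresh-separated apart ps q = All.map (λ p → AllLabels-map (apart p) q) ps

substs-¬ : ∀ s X → substs s (¬ X) ≡ ¬ substs s X
substs-¬ [] X = refl
substs-¬ ((i , j) ∷ s) X = substs-¬ s (subst i j X)

substs-∧ : ∀ s X Y → substs s (X ∧ Y) ≡ substs s X ∧ substs s Y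
substs-∧ [] X Y = refl
substs-∧ ((i , j) ∷ s) X Y = substs-∧ s (subst i j X) (subst i j Y)

substs-∨ : ∀ s X Y → substs s (X ∨ Y) ≡ substs s X ∨ substs s Y
substs-∨ [] X Y = refl
substs-∨ ((i , j) ∷ s) X Y = substs-∨ s (subst i j X) (subst i j Y)

substs-lor : ∀ s X Y → All (λ ij → proj₂ ij ≢ m) s →
             substs s (lor m X Y) ≡ lor m (substs s X) (substs s Y)
substs-lor [] X Y [] = refl
substs-lor ((i , j) ∷ s) X Y (j≢m ∷ ps) =
  trans (cong (substs s) (subst-lor-≢ i j≢m)) (substs-lor s (subst i j X) (subst i j Y) ps)

substs-++ : ∀ s t X → substs (s ++ t) X ≡ substs t (substs s X)
substs-++ s t X = foldl-++ _ X s t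

substs-++ˡ : ∀ s → Fresh t X → substs (s ++ t) X ≡ substs s X
substs-++ˡ {t} {X} s fresh = trans (substs-++ s t X)
  (substs-fresh (All.map (substs-AllLabels s) fresh))

substs-++ʳ : ∀ t → Fresh s Y → substs (s ++ t) Y ≡ substs t Y
substs-++ʳ {s} {Y} t fresh = trans (substs-++ s t Y) (cong (substs t) (substs-fresh fresh))

record DistinctIn (lo hi : ℕ) (s : List (Side × ℕ)) : Set where
  field
    above  : All (λ ij → lo ≤ proj₂ ij) s
    below  : All (λ ij → proj₂ ij < hi) s
    unique : Unique (map proj₂ s)
    short  : lo + length s ≤ hi

open DistinctIn

[]-DistinctIn : lo ≤ hi → DistinctIn lo hi []
[]-DistinctIn {lo} lo≤hi = record
  { above = [] ; below = [] ; unique = [] ; short = ≤-trans (≤-reflexive (+-identityʳ lo)) lo≤hi }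

[-]-DistinctIn : ∀ i m → DistinctIn m (suc m) [ (i , m) ]
[-]-DistinctIn i m = record
  { above = ≤-refl ∷ [] ; below = ≤-refl ∷ [] ; unique = [] ∷ [] ; short = ≤-reflexive (+-comm m 1) }

DistinctIn-mono : lo' ≤ lo → hi ≤ hi' → DistinctIn lo hi s → DistinctIn lo' hi' s
DistinctIn-mono {s = s} lo'≤lo hi≤hi' ds = record
  { above  = All.map (≤-trans lo'≤lo) (above ds)
  ; below  = All.map (λ j<hi → <-≤-trans j<hi hi≤hi') (below ds)
  ; unique = unique ds
  ; short  = ≤-trans (+-monoˡ-≤ (length s) lo'≤lo) (≤-trans (short ds) hi≤hi')
  }

separated-Disjoint : All (λ ij → proj₂ ij < m) s → All (λ ij → m ≤ proj₂ ij) t →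
                     Disjoint (map proj₂ s) (map proj₂ t)
separated-Disjoint s<m m≤t (j∈s , j∈t) =
  <-irrefl refl (<-≤-trans (All.lookup (All.map⁺ s<m) j∈s) (All.lookup (All.map⁺ m≤t) j∈t))

++-DistinctIn : DistinctIn lo mid s → DistinctIn mid' hi t → mid ≤ mid' → DistinctIn lo hi (s ++ t)
++-DistinctIn {lo} {mid} {s} {mid'} {hi} {t} ds dt mid≤mid' = record
  { above  = All.++⁺ (above ds) (All.map (≤-trans lo≤mid') (above dt))
  ; below  = All.++⁺ (All.map (λ j<mid → <-≤-trans j<mid mid≤hi) (below ds)) (below dt)
  ; unique = ≡.subst Unique (sym (map-++ proj₂ s t)) (Unique.++⁺ (unique ds) (unique dt)
               (separated-Disjoint (below ds) (All.map (≤-trans mid≤mid') (above dt))))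
  ; short  = begin
      lo + length (s ++ t)      ≡⟨ cong (lo +_) (length-++ s) ⟩
      lo + (length s + length t) ≡⟨ +-assoc lo (length s) (length t) ⟨
      lo + length s + length t   ≤⟨ +-monoˡ-≤ (length t) (≤-trans (short ds) mid≤mid') ⟩
      mid' + length t            ≤⟨ short dt ⟩
      hi                         ∎
  }
  where
  open ≤-Reasoning
  lo≤mid' : lo ≤ mid'
  lo≤mid' = ≤-trans (m≤m+n lo (length s)) (≤-trans (short ds) mid≤mid')
  mid≤hi : mid ≤ hi
  mid≤hi = ≤-trans mid≤mid' (≤-trans (m≤m+n mid' (length t)) (short dt))

record Resolvent (lo hi : ℕ) (X : LForm) (ρ : Form) : Set where
  constructor resolvent
  field
    steps    : List (Side × ℕ)
    distinct : DistinctIn lo hi steps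
    erases   : erase (substs steps X) ≡ ρ

open Resolvent

Resolvent-mono : lo' ≤ lo → hi ≤ hi' → Resolvent lo hi X ρ → Resolvent lo' hi' X ρ
Resolvent-mono lo'≤lo hi≤hi' (resolvent s ds e) = resolvent s (DistinctIn-mono lo'≤lo hi≤hi' ds) e

Resolvent-++ : mid ≤ mid' → AllLabels (_< mid) X → AllLabels (mid' ≤_) Y →
               (rX : Resolvent lo mid X ρ) (rY : Resolvent mid' hi Y σ) →
               let u = steps rX ++ steps rY in
               DistinctIn lo hi u × erase (substs u X) ≡ ρ × erase (substs u Y) ≡ σ
Resolvent-++ {mid} {mid'} mid≤mid' X<mid mid'≤Y (resolvent s ds eX) (resolvent t dt eY) =
  ++-DistinctIn ds dt mid≤mid' ,
  trans (cong erase (substs-++ˡ s (Fresh-separated (λ p q → ≢-sym (apart q p)) (above dt) X<mid))) eX ,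
  trans (cong erase (substs-++ʳ t (Fresh-separated apart (below ds) mid'≤Y))) eY
  where
  apart : ∀ {j k} → j < mid → mid' ≤ k → j ≢ k
  apart j<mid mid'≤k refl = <-irrefl refl (<-≤-trans j<mid (≤-trans mid≤mid' mid'≤k))

¬-Resolvent : Resolvent lo hi X ρ → Resolvent lo hi (¬ X) (¬ ρ)
¬-Resolvent {X = X} (resolvent s ds e) = resolvent s ds (trans (cong erase (substs-¬ s X)) (cong ¬_ e))

∧-Resolvent : AllLabels (_< mid) X → AllLabels (mid ≤_) Y →
              Resolvent lo mid X ρ → Resolvent mid hi Y σ → Resolvent lo hi (X ∧ Y) (ρ ∧ σ)
∧-Resolvent {X = X} {Y = Y} X<mid mid≤Y rX rY with Resolvent-++ ≤-refl X<mid mid≤Y rX rY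
... | du , eX , eY = resolvent u du (trans (cong erase (substs-∧ u X Y)) (cong₂ _∧_ eX eY))
  where u = steps rX ++ steps rY

∨-Resolvent : AllLabels (_< mid) X → AllLabels (mid ≤_) Y →
              Resolvent lo mid X ρ → Resolvent mid hi Y σ → Resolvent lo hi (X ∨ Y) (ρ ∨ σ)
∨-Resolvent {X = X} {Y = Y} X<mid mid≤Y rX rY with Resolvent-++ ≤-refl X<mid mid≤Y rX rY
... | du , eX , eY = resolvent u du (trans (cong erase (substs-∨ u X Y)) (cong₂ _∨_ eX eY))
  where u = steps rX ++ steps rY

lor-Resolvent : AllLabels (_< m) X → AllLabels (suc m ≤_) Y →
                Resolvent lo m X ρ → Resolvent (suc m) hi Y σ → Resolvent lo hi (lor m X Y) (ρ ⩔ σ)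
lor-Resolvent {m} {X} {Y} X<m m<Y rX rY with Resolvent-++ (n≤1+n m) X<m m<Y rX rY
... | du , eX , eY = resolvent u du (trans (cong erase (substs-lor u X Y avoid)) (cong₂ _⩔_ eX eY))
  where
  u = steps rX ++ steps rY
  avoid : All (λ ij → proj₂ ij ≢ m) u
  avoid = All.++⁺ (All.map <⇒≢ (below (distinct rX))) (All.map (≢-sym ∘ <⇒≢) (above (distinct rY)))

lorˡ-Resolvent : m < hi → Resolvent lo m X ρ → Resolvent lo hi (lor m X Y) ρ
lorˡ-Resolvent {m} {X = X} {Y = Y} m<hi (resolvent s ds e) = resolvent (s ++ [ (L , m) ])
  (DistinctIn-mono ≤-refl m<hi (++-DistinctIn ds ([-]-DistinctIn L m) ≤-refl)) (begin
    erase (substs (s ++ [ (L , m) ]) (lor m X Y))       ≡⟨ cong erase (substs-++ s _ _) ⟩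
    erase (subst L m (substs s (lor m X Y)))             ≡⟨ cong (erase ∘ subst L m) (substs-lor s X Y s≢m) ⟩
    erase (subst L m (lor m (substs s X) (substs s Y)))  ≡⟨ cong erase (subst-lor-≡ L m) ⟩
    erase (substs s X)                                   ≡⟨ e ⟩
    _                                                    ∎)
  where
  open ≡.≡-Reasoning
  s≢m : All (λ ij → proj₂ ij ≢ m) s
  s≢m = All.map <⇒≢ (below ds)

lorʳ-Resolvent : lo ≤ m → Resolvent (suc m) hi Y σ → Resolvent lo hi (lor m X Y) σ
lorʳ-Resolvent {m = m} lo≤m (resolvent t dt e) =
  resolvent ((R , m) ∷ t) (DistinctIn-mono lo≤m ≤-refl (++-DistinctIn ([-]-DistinctIn R m) dt ≤-refl))
    (trans (cong (erase ∘ substs t) (subst-lor-≡ R m)) e)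

↝⇒Resolvent : ∀ k → φ ↝ ρ → Resolvent k (k + ∣ φ ∣) (labelFrom k φ) ρ
↝⇒Resolvent k atom = resolvent [] ([]-DistinctIn (m≤m+n k 0)) refl
↝⇒Resolvent k ⊥f = resolvent [] ([]-DistinctIn (m≤m+n k 0)) refl
↝⇒Resolvent k (¬ p) = ¬-Resolvent (↝⇒Resolvent k p)
↝⇒Resolvent k (_∧_ {a} {b = b} p q) =
  Resolvent-mono ≤-refl (≤-reflexive (+-assoc k ∣ a ∣ ∣ b ∣))
    (∧-Resolvent (labelFrom-< k a) (labelFrom-≥ _ b) (↝⇒Resolvent k p) (↝⇒Resolvent _ q))
↝⇒Resolvent k (_∨_ {a} {b = b} p q) =
  Resolvent-mono ≤-refl (≤-reflexive (+-assoc k ∣ a ∣ ∣ b ∣))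
    (∨-Resolvent (labelFrom-< k a) (labelFrom-≥ _ b) (↝⇒Resolvent k p) (↝⇒Resolvent _ q))
↝⇒Resolvent k (_⩔_ {a} {b = b} p q) =
  Resolvent-mono ≤-refl (≤-reflexive (⩔-size k ∣ a ∣ ∣ b ∣))
    (lor-Resolvent (labelFrom-< k a) (labelFrom-≥ _ b) (↝⇒Resolvent k p) (↝⇒Resolvent _ q))
↝⇒Resolvent k (resolveˡ {a} {b = b} p) =
  lorˡ-Resolvent (≤-trans (m≤m+n _ ∣ b ∣) (≤-reflexive (⩔-size k ∣ a ∣ ∣ b ∣))) (↝⇒Resolvent k p)
↝⇒Resolvent k (resolveʳ {b} {a = a} q) =
  lorʳ-Resolvent (m≤m+n k ∣ a ∣)
    (Resolvent-mono ≤-refl (≤-reflexive (⩔-size k ∣ a ∣ ∣ b ∣)) (↝⇒Resolvent _ q))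

↝⇒PartialRes : φ ↝ ρ → PartialRes φ ρ
↝⇒PartialRes p with ↝⇒Resolvent 0 p
... | resolvent s ds e = length s , short ds , s , refl , below ds , unique ds , e

mainTheorem6 : ∀ {Γ Δ : List Form} → All WF Γ → All WF Δ →
    (D : Γ ⇒ Δ) → ∀ φ → φ ∈ formulas D →
    ∃[ ψ ] (ψ ∈ Γ ++ Δ × ∃[ ρ ] (PartialRes ψ ρ × Sub φ ρ))
mainTheorem6 _ _ D φ φ∈D with formulas-⊴ₛ D φ∈D
... | ψ , ψ∈ΓΔ , ρ , ψ↝ρ , φ⊑ρ = ψ , ψ∈ΓΔ , ρ , ↝⇒PartialRes ψ↝ρ , φ⊑ρ
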